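{- As formal power series in $q$, \[ A(q):=\frac{1}{(q;q)_\infty}\sum_{n\ge1}\frac{(-1)^{n-1}n\,q^{\frac{n^2+n}{2}}}{1-q^n}=\sum_{\lambda}t_s(\lambda)\,q^{|\lambda|}, \] where the sum on the right runs over all integer partitions $\lambda$.
   Context: $(q;q)_\infty=\prod_{n\ge1}(1-q^n)$. For a partition $\lambda$ of $N$ write $|\lambda|=N$. Let $n_\lambda$ be the largest integer such that $\lambda$ contains parts of each size $1,2,\ldots,n_\lambda$ (with $n_\lambda=0$ if $\lambda$ has no part equal to $1$), and let $m_k$ be the number of times the part $k$ appears in $\lambda$. The signed triangular weight of $\lambda$ is $t_s(\lambda):=\sum_{k=1}^{n_\lambda}(-1)^{k-1}k\,m_k$ (so $t_s(\lambda)=0$ if $\lambda$ has no part of size $1$). -}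

module Defs where

open import Data.Nat using (ℕ; zero; suc; _∸_; _≡ᵇ_) renaming (_+_ to _+ℕ_; _*_ to _*ℕ_)
open import Data.Integer using (ℤ; +_; -_; _+_; _*_; _-_; 0ℤ; 1ℤ)
open import Data.List using (List; []; _∷_; map; foldr; concatMap; zipWith; upTo; filterᵇ)
open import Data.Vec using (Vec; []; _∷_; toList)
open import Data.Bool using (Bool; if_then_else_)

FPS : Set
FPS = ℕ → ℤ

Σ< : ℕ → (ℕ → ℤ) → ℤ
Σ< zero    f = 0ℤ
Σ< (suc n) f = Σ< n f + f n

sumℤ : List ℤ → ℤ
sumℤ = foldr _+_ 0ℤ

_⊛_ : FPS → FPS → FPS
(f ⊛ g) k = Σ< (suc k) (λ i → f i * g (k ∸ i))

one : FPS
one zero    = 1ℤ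
one (suc _) = 0ℤ

oneMinusQ^ : ℕ → FPS
oneMinusQ^ n k = (if k ≡ᵇ 0 then 1ℤ else 0ℤ) - (if k ≡ᵇ n then 1ℤ else 0ℤ)

finPoch : ℕ → FPS
finPoch zero    = one
finPoch (suc N) = finPoch N ⊛ oneMinusQ^ (suc N)

-- (q;q)_∞ : its coefficient of q^N equals that of ∏_{n=1}^{N}(1 - q^n),
-- since the factors with n > N do not affect coefficients of q^k, k ≤ N.
qPochInf : FPS
qPochInf N = finPoch N N

-- Multiplicative inverse of a power series with constant term 1.
-- invRev f n = [b_n, …, b_1, b_0] where b_0 = 1 and
-- b_{n+1} = - Σ_{i=0}^{n} f(i+1) b_{n-i}, i.e. (f ⊛ b) = one when f 0 = 1.
invRev : FPS → ℕ → List ℤ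
invRev f zero    = 1ℤ ∷ []
invRev f (suc n) =
  (- sumℤ (zipWith _*_ (map (λ i → f (suc i)) (upTo (suc n))) (invRev f n))) ∷ invRev f n

headℤ : List ℤ → ℤ
headℤ []      = 0ℤ
headℤ (x ∷ _) = x

inv : FPS → FPS
inv f n = headℤ (invRev f n)

alt : ℕ → ℤ
alt zero    = 1ℤ
alt (suc k) = - alt k

tri : ℕ → ℕ
tri zero    = zero
tri (suc n) = suc n +ℕ tri n

-- S(q) = Σ_{n≥1} (-1)^{n-1} n q^{n(n+1)/2} / (1 - q^n)
--      = Σ_{n≥1} Σ_{j≥0} (-1)^{n-1} n q^{n(n+1)/2 + n j}.
-- Coefficient of q^k: only n ≤ k and j ≤ k can contribute (n(n+1)/2 ≥ n, n j ≥ j).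
Sser : FPS
Sser k = Σ< k (λ n' → Σ< (suc k) (λ j →
           if (tri (suc n') +ℕ suc n' *ℕ j) ≡ᵇ k
           then alt n' * (+ suc n')
           else 0ℤ))

Aser : FPS
Aser = inv qPochInf ⊛ Sser

-- Partitions of N encoded by multiplicity vectors m : Vec ℕ N, where the
-- i-th entry (i = 0..N-1) is m_{i+1}, the number of parts equal to i+1
-- (parts of a partition of N are ≤ N).
weight : {n : ℕ} → ℕ → Vec ℕ n → ℕ
weight k []       = 0
weight k (m ∷ ms) = k *ℕ m +ℕ weight (suc k) ms

boundedVecs : (n B : ℕ) → List (Vec ℕ n)
boundedVecs zero    B = [] ∷ []
boundedVecs (suc n) B = concatMap (λ x → map (x ∷_) (boundedVecs n B)) (upTo (suc B))

partitions : (N : ℕ) → List (Vec ℕ N)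
partitions N = filterᵇ (λ m → weight 1 m ≡ᵇ N) (boundedVecs N N)

-- t_s: go k' ms, where the head of ms is m_{k'+1}; stops at the first
-- part size that does not occur (so the sum runs over k = 1..n_λ).
tsGo : ℕ → List ℕ → ℤ
tsGo k' []            = 0ℤ
tsGo k' (zero  ∷ ms)  = 0ℤ
tsGo k' (suc m ∷ ms)  = alt k' * (+ (suc k' *ℕ suc m)) + tsGo (suc k') ms

ts : {N : ℕ} → Vec ℕ N → ℤ
ts m = tsGo 0 (toList m)

tsSeries : FPS
tsSeries N = sumℤ (map ts (partitions N))

module Submission where

-- Since (q;q)_∞ has constant term 1 and the formal inverse 'inv' really is an inverse,
-- it suffices to show  (q;q)_∞ · TS = S,  where TS = Σ_λ t_s(λ) q^{|λ|} and S = Sser.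
-- Up to degree N we may replace (q;q)_∞ by ∏_{j=1}^{N}(1-q^j), and multiplying by it is
-- the iterated difference operator  ΔΠ 0 N,  with  Δ r f = (1-q^r) f.
--
-- Partitions of degree ≤ N have parts ≤ N, so TS agrees up to degree N with  tsGF 0 N,
-- where  partGF k n = ∏_{j=k+1}^{k+n} 1/(1-q^j)  and  tsGF k n  are the generating
-- functions of partitions with parts in {k+1, …, k+n}, counted with weight 1 resp. with the
-- signed weight "tsGo k" (alternating sum starting at part k+1, stopping at the first gap).
-- Splitting off the multiplicity x of the smallest part k+1 gives geometric-sum recursions
-- for both; from them
--     ΔΠ k (n+1) (tsGF k (n+1)) = q^{k+1} ( (-1)^k (k+1)/(1-q^{k+1}) + ΔΠ (k+1) n (tsGF (k+1) n) ),
-- and unrolling this for k = 0 yields exactly the series S.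

open import Defs
open import Data.Nat using (ℕ; zero; suc; _∸_; _≡ᵇ_; _≤ᵇ_; _≤_; _<_; z≤n; s≤s; _≤?_) renaming (_+_ to _+ℕ_; _*_ to _*ℕ_)
open import Data.Integer using (ℤ; +_; -_; _+_; _*_; _-_; 0ℤ; 1ℤ)
open import Data.List using (List; []; _∷_; map; concatMap; zipWith; upTo; filterᵇ; applyUpTo; _++_)
open import Data.List.Properties using (map-++; map-∘; map-upTo)
open import Data.Vec using (Vec; []; _∷_; toList)
open import Data.Bool using (Bool; true; false; if_then_else_)
open import Data.Unit using (tt)
open import Data.Empty using (⊥-elim)
open import Function using (_∘_)
open import Relation.Binary.Definitions using (tri<; tri≈; tri>)
open import Relation.Nullary using (¬_; yes; no)
open import Relation.Binary.PropositionalEquality using (_≡_; refl; sym; trans; cong; cong₂; subst; module ≡-Reasoning)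
import Data.Nat.Properties as N
import Data.Integer.Properties as Z
open import Data.Integer.Tactic.RingSolver using (solve-∀)
open ≡-Reasoning

≤⇒≤ᵇ≡true : ∀ {m n} → m ≤ n → (m ≤ᵇ n) ≡ true
≤⇒≤ᵇ≡true {m} {n} p with m ≤ᵇ n | N.≤⇒≤ᵇ p
... | true | _ = refl

≰⇒≤ᵇ≡false : ∀ {m n} → ¬ (m ≤ n) → (m ≤ᵇ n) ≡ false
≰⇒≤ᵇ≡false {m} {n} p with m ≤ᵇ n | N.≤ᵇ⇒≤ m n
... | true | f = ⊥-elim (p (f tt))
... | false | _ = refl

≡⇒≡ᵇ≡true : ∀ {m n} → m ≡ n → (m ≡ᵇ n) ≡ true
≡⇒≡ᵇ≡true {m} {n} p with m ≡ᵇ n | N.≡⇒≡ᵇ m n p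
... | true | _ = refl

≢⇒≡ᵇ≡false : ∀ {m n} → ¬ (m ≡ n) → (m ≡ᵇ n) ≡ false
≢⇒≡ᵇ≡false {m} {n} p with m ≡ᵇ n | N.≡ᵇ⇒≡ m n
... | true | f = ⊥-elim (p (f tt))
... | false | _ = refl

≤ᵇ-shift : ∀ {p N} a → p ≤ N → (p +ℕ a ≤ᵇ N) ≡ (a ≤ᵇ N ∸ p)
≤ᵇ-shift {p} {N} a p≤N with a ≤? N ∸ p
... | yes q rewrite ≤⇒≤ᵇ≡true q = ≤⇒≤ᵇ≡true (subst (p +ℕ a ≤_) (N.m+[n∸m]≡n p≤N) (N.+-monoʳ-≤ p q))
... | no q rewrite ≰⇒≤ᵇ≡false q = ≰⇒≤ᵇ≡false (λ r → q (subst (_≤ N ∸ p) (N.m+n∸m≡n p a) (N.∸-monoˡ-≤ p r)))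

≡ᵇ-shift : ∀ {p N} e → p ≤ N → (p +ℕ e ≡ᵇ N) ≡ (e ≡ᵇ N ∸ p)
≡ᵇ-shift {p} {N} e p≤N with e N.≟ N ∸ p
... | yes q rewrite ≡⇒≡ᵇ≡true q = ≡⇒≡ᵇ≡true (trans (cong (p +ℕ_) q) (N.m+[n∸m]≡n p≤N))
... | no q rewrite ≢⇒≡ᵇ≡false q = ≢⇒≡ᵇ≡false (λ r → q (trans (sym (N.m+n∸m≡n p e)) (cong (_∸ p) r)))

≤-∸-swap : ∀ {a r N} → a ≤ N → r ≤ N ∸ a → a ≤ N ∸ r
≤-∸-swap {a} {r} {N} a≤N q = subst (_≤ N ∸ r) (N.m+n∸n≡m a r)
  (N.∸-monoˡ-≤ r (subst (a +ℕ r ≤_) (N.m+[n∸m]≡n a≤N) (N.+-monoʳ-≤ a q)))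

if-cong : ∀ {b b' : Bool} {X X' : ℤ} → b ≡ b' → X ≡ X' → (if b then X else 0ℤ) ≡ (if b' then X' else 0ℤ)
if-cong refl refl = refl

if-≰ : ∀ {a b} (X : ℤ) → ¬ a ≤ b → (if a ≤ᵇ b then X else 0ℤ) ≡ 0ℤ
if-≰ X p rewrite ≰⇒≤ᵇ≡false p = refl

if-0 : ∀ (b : Bool) → (if b then 0ℤ else 0ℤ) ≡ 0ℤ
if-0 true = refl
if-0 false = refl

if-+ : ∀ (b : Bool) (a c : ℤ) → (if b then a + c else 0ℤ) ≡ (if b then a else 0ℤ) + (if b then c else 0ℤ)
if-+ true a c = refl
if-+ false a c = refl

if-- : ∀ (b : Bool) (a c : ℤ) → (if b then a - c else 0ℤ) ≡ (if b then a else 0ℤ) - (if b then c else 0ℤ)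
if-- true a c = refl
if-- false a c = refl

if-affine : ∀ (b : Bool) c g → (if b then c + g else 0ℤ) ≡ c * (if b then 1ℤ else 0ℤ) + (if b then g else 0ℤ)
if-affine true c g = cong (_+ g) (sym (Z.*-identityʳ c))
if-affine false c g = sym (trans (Z.+-identityʳ (c * 0ℤ)) (Z.*-zeroʳ c))

Σ<-cong : ∀ n {f g : ℕ → ℤ} → (∀ i → i < n → f i ≡ g i) → Σ< n f ≡ Σ< n g
Σ<-cong zero h = refl
Σ<-cong (suc n) h = cong₂ _+_ (Σ<-cong n (λ i i<n → h i (N.m≤n⇒m≤1+n i<n))) (h n N.≤-refl)

Σ<-vanish : ∀ n {f : ℕ → ℤ} → (∀ i → i < n → f i ≡ 0ℤ) → Σ< n f ≡ 0ℤ
Σ<-vanish zero h = refl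
Σ<-vanish (suc n) h rewrite Σ<-vanish n (λ i i<n → h i (N.m≤n⇒m≤1+n i<n)) | h n N.≤-refl = refl

Σ<-head : ∀ n (f : ℕ → ℤ) → Σ< (suc n) f ≡ f 0 + Σ< n (λ i → f (suc i))
Σ<-head zero f = trans (Z.+-identityˡ (f 0)) (sym (Z.+-identityʳ (f 0)))
Σ<-head (suc n) f = begin
  Σ< (suc n) f + f (suc n)                    ≡⟨ cong (_+ f (suc n)) (Σ<-head n f) ⟩
  (f 0 + Σ< n (λ i → f (suc i))) + f (suc n) ≡⟨ Z.+-assoc (f 0) _ _ ⟩
  f 0 + Σ< (suc n) (λ i → f (suc i))          ∎

Σ<-+ : ∀ n (f g : ℕ → ℤ) → Σ< n (λ i → f i + g i) ≡ Σ< n f + Σ< n g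
Σ<-+ zero f g = refl
Σ<-+ (suc n) f g rewrite Σ<-+ n f g = interchange (Σ< n f) (Σ< n g) (f n) (g n)
  where
  interchange : ∀ a b c d → (a + b) + (c + d) ≡ (a + c) + (b + d)
  interchange = solve-∀

Σ<-- : ∀ n (f g : ℕ → ℤ) → Σ< n (λ i → f i - g i) ≡ Σ< n f - Σ< n g
Σ<-- zero f g = refl
Σ<-- (suc n) f g rewrite Σ<-- n f g = interchange (Σ< n f) (Σ< n g) (f n) (g n)
  where
  interchange : ∀ a b c d → (a - b) + (c - d) ≡ (a + c) - (b + d)
  interchange = solve-∀

Σ<-*ˡ : ∀ n c (f : ℕ → ℤ) → Σ< n (λ i → c * f i) ≡ c * Σ< n f
Σ<-*ˡ zero c f = sym (Z.*-zeroʳ c)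
Σ<-*ˡ (suc n) c f rewrite Σ<-*ˡ n c f = sym (Z.*-distribˡ-+ c (Σ< n f) (f n))

Σ<-*ʳ : ∀ n c (f : ℕ → ℤ) → Σ< n (λ i → f i * c) ≡ Σ< n f * c
Σ<-*ʳ zero c f = refl
Σ<-*ʳ (suc n) c f rewrite Σ<-*ʳ n c f = sym (Z.*-distribʳ-+ c (Σ< n f) (f n))

Σ<-if : ∀ m (b : Bool) (X : ℕ → ℤ) → Σ< m (λ i → if b then X i else 0ℤ) ≡ (if b then Σ< m X else 0ℤ)
Σ<-if m true X = refl
Σ<-if m false X = Σ<-vanish m (λ _ _ → refl)

Σ<-pad : ∀ n m {f : ℕ → ℤ} → n ≤ m → (∀ i → n ≤ i → i < m → f i ≡ 0ℤ) → Σ< m f ≡ Σ< n f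
Σ<-pad n zero z≤n h = refl
Σ<-pad n (suc m) n≤sm h with n ≤? m
... | yes n≤m rewrite Σ<-pad n m n≤m (λ i a b → h i a (N.m≤n⇒m≤1+n b)) | h m n≤m N.≤-refl = Z.+-identityʳ _
... | no n≰m with N.≤-antisym n≤sm (N.≰⇒> n≰m)
... | refl = refl

Σ<-reverse : ∀ n (h : ℕ → ℤ) → Σ< (suc n) h ≡ Σ< (suc n) (λ i → h (n ∸ i))
Σ<-reverse zero h = refl
Σ<-reverse (suc n) h = begin
  Σ< (suc n) h + h (suc n)                     ≡⟨ cong (_+ h (suc n)) (Σ<-reverse n h) ⟩
  Σ< (suc n) (λ i → h (n ∸ i)) + h (suc n)     ≡⟨ Z.+-comm _ (h (suc n)) ⟩
  h (suc n) + Σ< (suc n) (λ i → h (n ∸ i))     ≡⟨ sym (Σ<-head (suc n) (λ i → h (suc n ∸ i))) ⟩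
  Σ< (suc (suc n)) (λ i → h (suc n ∸ i))       ∎

Σ<-triangle : ∀ N (F : ℕ → ℕ → ℤ) →
  Σ< (suc N) (λ i → Σ< (suc i) (λ j → F i j)) ≡ Σ< (suc N) (λ j → Σ< (suc (N ∸ j)) (λ t → F (j +ℕ t) j))
Σ<-triangle zero F = refl
Σ<-triangle (suc M) F = begin
  Σ< (suc M) (λ i → Σ< (suc i) (λ j → F i j)) + Σ< (suc (suc M)) (F (suc M))
    ≡⟨ cong (_+ Σ< (suc (suc M)) (F (suc M))) (Σ<-triangle M F) ⟩
  Σ< (suc M) G + (Σ< (suc M) (F (suc M)) + F (suc M) (suc M))
    ≡⟨ sym (Z.+-assoc (Σ< (suc M) G) _ _) ⟩
  (Σ< (suc M) G + Σ< (suc M) (F (suc M))) + F (suc M) (suc M)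
    ≡⟨ cong₂ _+_ (sym (Σ<-+ (suc M) G (F (suc M)))) lastColumn ⟩
  Σ< (suc M) (λ j → G j + F (suc M) j) + H (suc M)
    ≡⟨ cong (_+ H (suc M)) (Σ<-cong (suc M) extendColumn) ⟩
  Σ< (suc M) H + H (suc M) ∎
  where
  G H : ℕ → ℤ
  G j = Σ< (suc (M ∸ j)) (λ t → F (j +ℕ t) j)
  H j = Σ< (suc (suc M ∸ j)) (λ t → F (j +ℕ t) j)
  lastColumn : F (suc M) (suc M) ≡ H (suc M)
  lastColumn rewrite N.n∸n≡0 M | N.+-identityʳ M = sym (Z.+-identityˡ _)
  extendColumn : ∀ j → j < suc M → G j + F (suc M) j ≡ H j
  extendColumn j (s≤s j≤M) rewrite N.+-∸-assoc 1 j≤M | N.+-suc j (M ∸ j) | N.m+[n∸m]≡n j≤M = refl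

Σ<-indicator : ∀ n k (g : ℕ → ℤ) →
  Σ< n (λ i → (if i ≡ᵇ k then 1ℤ else 0ℤ) * g i) ≡ (if suc k ≤ᵇ n then g k else 0ℤ)
Σ<-indicator zero k g = refl
Σ<-indicator (suc n) k g with N.<-cmp n k
... | tri< n<k _ _ rewrite Σ<-indicator n k g
    | ≰⇒≤ᵇ≡false {suc k} {n} (λ q → N.<⇒≱ n<k (N.≤-trans (N.n≤1+n k) q))
    | ≰⇒≤ᵇ≡false {suc k} {suc n} (λ q → N.<⇒≱ n<k (N.≤-pred q))
    | ≢⇒≡ᵇ≡false {n} {k} (λ e → N.<-irrefl e n<k) = refl
... | tri≈ _ refl _ rewrite Σ<-indicator n n g | ≰⇒≤ᵇ≡false {suc n} {n} (N.<-irrefl refl)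
    | ≤⇒≤ᵇ≡true {suc n} {suc n} N.≤-refl | ≡⇒≡ᵇ≡true {n} {n} refl = trans (Z.+-identityˡ _) (Z.*-identityˡ (g n))
... | tri> _ _ k<n rewrite Σ<-indicator n k g | ≤⇒≤ᵇ≡true {suc k} {n} k<n
    | ≤⇒≤ᵇ≡true {suc k} {suc n} (N.m≤n⇒m≤1+n k<n)
    | ≢⇒≡ᵇ≡false {n} {k} (λ e → N.<-irrefl (sym e) k<n) = Z.+-identityʳ (g k)

AgreeUpTo : ℕ → FPS → FPS → Set
AgreeUpTo N f g = ∀ M → M ≤ N → f M ≡ g M

⊛-cong : ∀ N {f f' g g' : FPS} → AgreeUpTo N f f' → AgreeUpTo N g g' → (f ⊛ g) N ≡ (f' ⊛ g') N
⊛-cong N hf hg = Σ<-cong (suc N) (λ i i<sN → cong₂ _*_ (hf i (N.≤-pred i<sN)) (hg (N ∸ i) (N.m∸n≤m N i)))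

⊛-comm : ∀ (f g : FPS) N → (f ⊛ g) N ≡ (g ⊛ f) N
⊛-comm f g N = begin
  Σ< (suc N) (λ i → f i * g (N ∸ i))               ≡⟨ Σ<-reverse N _ ⟩
  Σ< (suc N) (λ i → f (N ∸ i) * g (N ∸ (N ∸ i)))   ≡⟨ Σ<-cong (suc N) swapFactors ⟩
  Σ< (suc N) (λ i → g i * f (N ∸ i))               ∎
  where
  swapFactors : ∀ i → i < suc N → f (N ∸ i) * g (N ∸ (N ∸ i)) ≡ g i * f (N ∸ i)
  swapFactors i i<sN rewrite N.m∸[m∸n]≡n (N.≤-pred i<sN) = Z.*-comm (f (N ∸ i)) (g i)

⊛-assoc : ∀ (f g h : FPS) N → ((f ⊛ g) ⊛ h) N ≡ (f ⊛ (g ⊛ h)) N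
⊛-assoc f g h N = begin
  Σ< (suc N) (λ i → Σ< (suc i) (λ j → f j * g (i ∸ j)) * h (N ∸ i))
    ≡⟨ Σ<-cong (suc N) (λ i _ → sym (Σ<-*ʳ (suc i) (h (N ∸ i)) (λ j → f j * g (i ∸ j)))) ⟩
  Σ< (suc N) (λ i → Σ< (suc i) (λ j → f j * g (i ∸ j) * h (N ∸ i)))
    ≡⟨ Σ<-triangle N (λ i j → f j * g (i ∸ j) * h (N ∸ i)) ⟩
  Σ< (suc N) (λ j → Σ< (suc (N ∸ j)) (λ t → f j * g (j +ℕ t ∸ j) * h (N ∸ (j +ℕ t))))
    ≡⟨ Σ<-cong (suc N) (λ j _ → trans (Σ<-cong (suc (N ∸ j)) (λ t _ → reassociate j t))
                                        (Σ<-*ˡ (suc (N ∸ j)) (f j) (λ t → g t * h (N ∸ j ∸ t)))) ⟩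
  Σ< (suc N) (λ j → f j * Σ< (suc (N ∸ j)) (λ t → g t * h (N ∸ j ∸ t))) ∎
  where
  reassociate : ∀ j t → f j * g (j +ℕ t ∸ j) * h (N ∸ (j +ℕ t)) ≡ f j * (g t * h (N ∸ j ∸ t))
  reassociate j t rewrite N.m+n∸m≡n j t | sym (N.∸-+-assoc N j t) = Z.*-assoc (f j) (g t) _

⊛-oneˡ : ∀ (g : FPS) N → (one ⊛ g) N ≡ g N
⊛-oneˡ g N = begin
  Σ< (suc N) (λ i → one i * g (N ∸ i))                    ≡⟨ Σ<-head N _ ⟩
  1ℤ * g N + Σ< N (λ i → one (suc i) * g (N ∸ suc i))     ≡⟨ cong₂ _+_ (Z.*-identityˡ (g N)) (Σ<-vanish N (λ i _ → refl)) ⟩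
  g N + 0ℤ                                                ≡⟨ Z.+-identityʳ (g N) ⟩
  g N                                                     ∎

invRev-coefficients : ∀ f n → invRev f n ≡ applyUpTo (λ i → inv f (n ∸ i)) (suc n)
invRev-coefficients f zero = refl
invRev-coefficients f (suc n) = cong (inv f (suc n) ∷_) (invRev-coefficients f n)

sum-zipWith-* : ∀ m (a b : ℕ → ℤ) → sumℤ (zipWith _*_ (applyUpTo a m) (applyUpTo b m)) ≡ Σ< m (λ i → a i * b i)
sum-zipWith-* zero a b = refl
sum-zipWith-* (suc m) a b =
  trans (cong (λ z → a 0 * b 0 + z) (sum-zipWith-* m (a ∘ suc) (b ∘ suc))) (sym (Σ<-head m (λ i → a i * b i)))

inv-suc : ∀ f n → inv f (suc n) ≡ - Σ< (suc n) (λ i → f (suc i) * inv f (n ∸ i))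
inv-suc f n = cong -_ (begin
  sumℤ (zipWith _*_ (map (λ i → f (suc i)) (upTo (suc n))) (invRev f n))
    ≡⟨ cong₂ (λ x y → sumℤ (zipWith _*_ x y)) (map-upTo (λ i → f (suc i)) (suc n)) (invRev-coefficients f n) ⟩
  sumℤ (zipWith _*_ (applyUpTo (λ i → f (suc i)) (suc n)) (applyUpTo (λ i → inv f (n ∸ i)) (suc n)))
    ≡⟨ sum-zipWith-* (suc n) (λ i → f (suc i)) (λ i → inv f (n ∸ i)) ⟩
  Σ< (suc n) (λ i → f (suc i) * inv f (n ∸ i)) ∎)

inv-right : ∀ (f : FPS) → f 0 ≡ 1ℤ → ∀ N → (f ⊛ inv f) N ≡ one N
inv-right f f0 zero rewrite f0 = refl
inv-right f f0 (suc n) = begin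
  Σ< (suc (suc n)) (λ i → f i * inv f (suc n ∸ i))   ≡⟨ Σ<-head (suc n) _ ⟩
  f 0 * inv f (suc n) + X                            ≡⟨ cong₂ (λ a b → a * b + X) f0 (inv-suc f n) ⟩
  1ℤ * (- X) + X                                     ≡⟨ cancel X ⟩
  0ℤ                                                 ∎
  where
  X = Σ< (suc n) (λ i → f (suc i) * inv f (n ∸ i))
  cancel : ∀ x → 1ℤ * (- x) + x ≡ 0ℤ
  cancel = solve-∀

inv-solve : ∀ (f g s : FPS) → f 0 ≡ 1ℤ → (∀ M → (f ⊛ g) M ≡ s M) → ∀ N → (inv f ⊛ s) N ≡ g N
inv-solve f g s f0 fg≡s N = begin
  (inv f ⊛ s) N          ≡⟨ ⊛-cong N {inv f} {inv f} {s} {f ⊛ g} (λ _ _ → refl) (λ M _ → sym (fg≡s M)) ⟩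
  (inv f ⊛ (f ⊛ g)) N    ≡⟨ sym (⊛-assoc (inv f) f g N) ⟩
  ((inv f ⊛ f) ⊛ g) N    ≡⟨ ⊛-cong N {g = g} {g} (λ M _ → trans (⊛-comm (inv f) f M) (inv-right f f0 M)) (λ _ _ → refl) ⟩
  (one ⊛ g) N            ≡⟨ ⊛-oneˡ g N ⟩
  g N                    ∎

shift : ℕ → FPS → FPS
shift r f N = if r ≤ᵇ N then f (N ∸ r) else 0ℤ

shift-cong : ∀ r {f g : FPS} → (∀ M → f M ≡ g M) → ∀ N → shift r f N ≡ shift r g N
shift-cong r h N = if-cong refl (h (N ∸ r))

shift-- : ∀ r (f g : FPS) N → shift r f N - shift r g N ≡ shift r (λ M → f M - g M) N
shift-- r f g N = sym (if-- (r ≤ᵇ N) _ _)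

Δ : ℕ → FPS → FPS
Δ r f N = f N - shift r f N

Δ-cong : ∀ r N {f g : FPS} → AgreeUpTo N f g → AgreeUpTo N (Δ r f) (Δ r g)
Δ-cong r N {f} {g} h M M≤N with r ≤ᵇ M
... | true = cong₂ _-_ (h M M≤N) (h (M ∸ r) (N.≤-trans (N.m∸n≤m M r) M≤N))
... | false = cong (_- 0ℤ) (h M M≤N)

Δ-+ : ∀ r (f g : FPS) N → Δ r (λ M → f M + g M) N ≡ Δ r f N + Δ r g N
Δ-+ r f g N with r ≤ᵇ N
... | true = interchange (f N) (g N) (f (N ∸ r)) (g (N ∸ r))
  where
  interchange : ∀ a b c d → (a + b) - (c + d) ≡ (a - c) + (b - d)
  interchange = solve-∀
... | false = interchange (f N) (g N)
  where
  interchange : ∀ a b → (a + b) - 0ℤ ≡ (a - 0ℤ) + (b - 0ℤ)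
  interchange = solve-∀

Δ-* : ∀ r c (f : FPS) N → Δ r (λ M → c * f M) N ≡ c * Δ r f N
Δ-* r c f N with r ≤ᵇ N
... | true = distrib c (f N) (f (N ∸ r))
  where
  distrib : ∀ c a b → c * a - c * b ≡ c * (a - b)
  distrib = solve-∀
... | false = distrib c (f N)
  where
  distrib : ∀ c a → c * a - 0ℤ ≡ c * (a - 0ℤ)
  distrib = solve-∀

oneMinusQ^-⊛ : ∀ k (f : FPS) N → (oneMinusQ^ (suc k) ⊛ f) N ≡ Δ (suc k) f N
oneMinusQ^-⊛ k f N = begin
  Σ< (suc N) (λ i → oneMinusQ^ (suc k) i * f (N ∸ i))                     ≡⟨ Σ<-head N _ ⟩
  1ℤ * f N + Σ< N (λ i → (0ℤ - [ i ]) * f (N ∸ suc i))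
    ≡⟨ cong (λ z → 1ℤ * f N + z) (trans (Σ<-cong N (λ i _ → pullSign [ i ] (f (N ∸ suc i))))
                                 (Σ<-*ˡ N (- 1ℤ) (λ i → [ i ] * f (N ∸ suc i)))) ⟩
  1ℤ * f N + - 1ℤ * Σ< N (λ i → [ i ] * f (N ∸ suc i))
    ≡⟨ cong (λ z → 1ℤ * f N + - 1ℤ * z) (Σ<-indicator N k (λ i → f (N ∸ suc i))) ⟩
  1ℤ * f N + - 1ℤ * shift (suc k) f N                                      ≡⟨ difference (f N) _ ⟩
  Δ (suc k) f N                                                            ∎
  where
  [_] : ℕ → ℤ
  [ i ] = if i ≡ᵇ k then 1ℤ else 0ℤ
  pullSign : ∀ b x → (0ℤ - b) * x ≡ - 1ℤ * (b * x)
  pullSign = solve-∀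
  difference : ∀ a b → 1ℤ * a + - 1ℤ * b ≡ a - b
  difference = solve-∀

-- Multiplication by  ∏_{j=k+1}^{k+n} (1 - q^j)  as an iterated difference operator.
ΔΠ : ℕ → ℕ → FPS → FPS
ΔΠ k zero f = f
ΔΠ k (suc n) f = ΔΠ (suc k) n (Δ (suc k) f)

ΔΠ-cong : ∀ n k N {f g : FPS} → AgreeUpTo N f g → AgreeUpTo N (ΔΠ k n f) (ΔΠ k n g)
ΔΠ-cong zero k N h = h
ΔΠ-cong (suc n) k N h = ΔΠ-cong n (suc k) N (Δ-cong (suc k) N h)

ΔΠ-last : ∀ n k (f : FPS) N → ΔΠ k (suc n) f N ≡ Δ (suc (k +ℕ n)) (ΔΠ k n f) N
ΔΠ-last zero k f N rewrite N.+-identityʳ k = refl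
ΔΠ-last (suc m) k f N rewrite N.+-suc k m = ΔΠ-last m (suc k) (Δ (suc k) f) N

ΔΠ-+ : ∀ n k (f g : FPS) N → ΔΠ k n (λ M → f M + g M) N ≡ ΔΠ k n f N + ΔΠ k n g N
ΔΠ-+ zero k f g N = refl
ΔΠ-+ (suc n) k f g N = trans (ΔΠ-cong n (suc k) N (λ M _ → Δ-+ (suc k) f g M) N N.≤-refl)
                             (ΔΠ-+ n (suc k) (Δ (suc k) f) (Δ (suc k) g) N)

ΔΠ-* : ∀ n k c (f : FPS) N → ΔΠ k n (λ M → c * f M) N ≡ c * ΔΠ k n f N
ΔΠ-* zero k c f N = refl
ΔΠ-* (suc n) k c f N = trans (ΔΠ-cong n (suc k) N (λ M _ → Δ-* (suc k) c f M) N N.≤-refl)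
                             (ΔΠ-* n (suc k) c (Δ (suc k) f) N)

ΔΠ-zero : ∀ n k N → ΔΠ k n (λ _ → 0ℤ) N ≡ 0ℤ
ΔΠ-zero n k N = trans (ΔΠ-cong n k N (λ M _ → sym (Z.*-zeroˡ 0ℤ)) N N.≤-refl)
                (trans (ΔΠ-* n k 0ℤ (λ _ → 0ℤ) N) (Z.*-zeroˡ (ΔΠ k n (λ _ → 0ℤ) N)))

finPoch-⊛-step : ∀ n (f : FPS) N → (finPoch (suc n) ⊛ f) N ≡ Δ (suc n) (finPoch n ⊛ f) N
finPoch-⊛-step n f N = begin
  ((finPoch n ⊛ oneMinusQ^ (suc n)) ⊛ f) N
    ≡⟨ ⊛-cong N {g = f} {f} (λ i _ → ⊛-comm (finPoch n) (oneMinusQ^ (suc n)) i) (λ _ _ → refl) ⟩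
  ((oneMinusQ^ (suc n) ⊛ finPoch n) ⊛ f) N    ≡⟨ ⊛-assoc (oneMinusQ^ (suc n)) (finPoch n) f N ⟩
  (oneMinusQ^ (suc n) ⊛ (finPoch n ⊛ f)) N    ≡⟨ oneMinusQ^-⊛ n (finPoch n ⊛ f) N ⟩
  Δ (suc n) (finPoch n ⊛ f) N                 ∎

finPoch-⊛ : ∀ n (f : FPS) N → (finPoch n ⊛ f) N ≡ ΔΠ 0 n f N
finPoch-⊛ zero f N = ⊛-oneˡ f N
finPoch-⊛ (suc n) f N = begin
  (finPoch (suc n) ⊛ f) N       ≡⟨ finPoch-⊛-step n f N ⟩
  Δ (suc n) (finPoch n ⊛ f) N   ≡⟨ Δ-cong (suc n) N (λ M _ → finPoch-⊛ n f M) N N.≤-refl ⟩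
  Δ (suc n) (ΔΠ 0 n f) N        ≡⟨ sym (ΔΠ-last n 0 f N) ⟩
  ΔΠ 0 (suc n) f N              ∎

finPoch-stable : ∀ n → AgreeUpTo n (finPoch (suc n)) (finPoch n)
finPoch-stable n i i≤n = begin
  (finPoch n ⊛ oneMinusQ^ (suc n)) i   ≡⟨ ⊛-comm (finPoch n) (oneMinusQ^ (suc n)) i ⟩
  (oneMinusQ^ (suc n) ⊛ finPoch n) i   ≡⟨ oneMinusQ^-⊛ n (finPoch n) i ⟩
  finPoch n i - shift (suc n) (finPoch n) i
    ≡⟨ cong (λ z → finPoch n i - z) (if-≰ (finPoch n (i ∸ suc n)) (λ q → N.<⇒≱ q i≤n)) ⟩
  finPoch n i - 0ℤ                      ≡⟨ Z.+-identityʳ (finPoch n i) ⟩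
  finPoch n i                           ∎

qPochInf-finPoch : ∀ N → AgreeUpTo N qPochInf (finPoch N)
qPochInf-finPoch zero .zero z≤n = refl
qPochInf-finPoch (suc M) i i≤sM with i ≤? M
... | yes i≤M = trans (qPochInf-finPoch M i i≤M) (sym (finPoch-stable M i i≤M))
... | no i≰M with N.≤-antisym i≤sM (N.≰⇒> i≰M)
... | refl = refl

qPochInf-⊛ : ∀ (f : FPS) N → (qPochInf ⊛ f) N ≡ ΔΠ 0 N f N
qPochInf-⊛ f N = trans (⊛-cong N {g = f} {f} (qPochInf-finPoch N) (λ _ _ → refl)) (finPoch-⊛ N f N)

-- Geometric sums:  geoSum p F  is the series  Σ_{x ≥ 0} q^{p x} · F x.

geoSum : ℕ → (ℕ → FPS) → FPS
geoSum p F N = Σ< (suc N) (λ x → if p *ℕ x ≤ᵇ N then F x (N ∸ p *ℕ x) else 0ℤ)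

geoSum-cong : ∀ p (F G : ℕ → FPS) N → (∀ x → AgreeUpTo N (F x) (G x)) → geoSum p F N ≡ geoSum p G N
geoSum-cong p F G N h = Σ<-cong (suc N) (λ x _ → if-cong refl (h x (N ∸ p *ℕ x) (N.m∸n≤m N (p *ℕ x))))

geoSum-+ : ∀ p (F G : ℕ → FPS) N → geoSum p (λ x M → F x M + G x M) N ≡ geoSum p F N + geoSum p G N
geoSum-+ p F G N = trans (Σ<-cong (suc N) (λ x _ → if-+ (p *ℕ x ≤ᵇ N) _ _)) (Σ<-+ (suc N) _ _)

geoSum-- : ∀ p (F G : ℕ → FPS) N → geoSum p (λ x M → F x M - G x M) N ≡ geoSum p F N - geoSum p G N
geoSum-- p F G N = trans (Σ<-cong (suc N) (λ x _ → if-- (p *ℕ x ≤ᵇ N) _ _)) (Σ<-- (suc N) _ _)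

geoSum-zero : ∀ p N → geoSum p (λ _ _ → 0ℤ) N ≡ 0ℤ
geoSum-zero p N = Σ<-vanish (suc N) (λ x _ → if-0 (p *ℕ x ≤ᵇ N))

geoSum-tail : ∀ k (G : ℕ → FPS) N →
  Σ< N (λ x → if suc k *ℕ suc x ≤ᵇ N then G x (N ∸ suc k *ℕ suc x) else 0ℤ) ≡ shift (suc k) (geoSum (suc k) G) N
geoSum-tail k G N with suc k ≤? N
... | no p≰N rewrite ≰⇒≤ᵇ≡false p≰N =
  Σ<-vanish N (λ x _ → if-≰ _ (λ q → p≰N (N.≤-trans (N.m≤m*n (suc k) (suc x)) q)))
... | yes p≤N rewrite ≤⇒≤ᵇ≡true p≤N = begin
  Σ< N (λ x → if p *ℕ suc x ≤ᵇ N then G x (N ∸ p *ℕ suc x) else 0ℤ)   ≡⟨ Σ<-cong N (λ x _ → reindex x) ⟩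
  Σ< N (λ x → if p *ℕ x ≤ᵇ N ∸ p then G x (N ∸ p ∸ p *ℕ x) else 0ℤ)
    ≡⟨ Σ<-pad (suc (N ∸ p)) N (remaining p≤N) (λ x a _ → if-≰ _ (λ q → N.<⇒≱ a (N.≤-trans (N.m≤n*m x p) q))) ⟩
  geoSum p G (N ∸ p) ∎
  where
  p = suc k
  remaining : ∀ {M} → suc k ≤ M → suc (M ∸ suc k) ≤ M
  remaining {suc M'} (s≤s _) = s≤s (N.m∸n≤m M' k)
  reindex : ∀ x → (if p *ℕ suc x ≤ᵇ N then G x (N ∸ p *ℕ suc x) else 0ℤ)
                ≡ (if p *ℕ x ≤ᵇ N ∸ p then G x (N ∸ p ∸ p *ℕ x) else 0ℤ)
  reindex x = if-cong (trans (cong (_≤ᵇ N) (N.*-suc p x)) (≤ᵇ-shift (p *ℕ x) p≤N))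
                      (cong (G x) (trans (cong (N ∸_) (N.*-suc p x)) (sym (N.∸-+-assoc N p (p *ℕ x)))))

geoSum-unfold : ∀ k (F : ℕ → FPS) N → geoSum (suc k) F N ≡ F 0 N + shift (suc k) (geoSum (suc k) (F ∘ suc)) N
geoSum-unfold k F N = begin
  geoSum (suc k) F N ≡⟨ Σ<-head N _ ⟩
  (if suc k *ℕ 0 ≤ᵇ N then F 0 (N ∸ suc k *ℕ 0) else 0ℤ)
    + Σ< N (λ x → if suc k *ℕ suc x ≤ᵇ N then F (suc x) (N ∸ suc k *ℕ suc x) else 0ℤ)
    ≡⟨ cong₂ _+_ (cong (λ z → if z ≤ᵇ N then F 0 (N ∸ z) else 0ℤ) (N.*-zeroʳ (suc k))) (geoSum-tail k (F ∘ suc) N) ⟩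
  F 0 N + shift (suc k) (geoSum (suc k) (F ∘ suc)) N ∎

atFirst : FPS → ℕ → FPS
atFirst f zero = f
atFirst f (suc _) = λ _ → 0ℤ

atSecond : FPS → ℕ → FPS
atSecond f zero = λ _ → 0ℤ
atSecond f (suc x) = atFirst f x

geoSum-atFirst : ∀ k (f : FPS) N → geoSum (suc k) (atFirst f) N ≡ f N
geoSum-atFirst k f N = begin
  geoSum (suc k) (atFirst f) N                                    ≡⟨ geoSum-unfold k (atFirst f) N ⟩
  f N + shift (suc k) (geoSum (suc k) (λ _ _ → 0ℤ)) N             ≡⟨ cong (λ z → f N + z) (shift-cong (suc k) (geoSum-zero (suc k)) N) ⟩
  f N + shift (suc k) (λ _ → 0ℤ) N                                ≡⟨ cong (λ z → f N + z) (if-0 (suc k ≤ᵇ N)) ⟩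
  f N + 0ℤ                                                        ≡⟨ Z.+-identityʳ (f N) ⟩
  f N                                                             ∎

geoSum-atSecond : ∀ k (f : FPS) N → geoSum (suc k) (atSecond f) N ≡ shift (suc k) f N
geoSum-atSecond k f N = begin
  geoSum (suc k) (atSecond f) N                                   ≡⟨ geoSum-unfold k (atSecond f) N ⟩
  0ℤ + shift (suc k) (geoSum (suc k) (atFirst f)) N               ≡⟨ Z.+-identityˡ _ ⟩
  shift (suc k) (geoSum (suc k) (atFirst f)) N                    ≡⟨ shift-cong (suc k) (geoSum-atFirst k f) N ⟩
  shift (suc k) f N                                               ∎

geoSum-shift : ∀ p r (F : ℕ → FPS) N → geoSum (suc p) (λ x → shift r (F x)) N ≡ shift r (geoSum (suc p) F) N
geoSum-shift p r F N with r ≤? N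
... | no r≰N rewrite ≰⇒≤ᵇ≡false r≰N = Σ<-vanish (suc N) tooSmall
  where
  tooSmall : ∀ x → x < suc N → (if suc p *ℕ x ≤ᵇ N then shift r (F x) (N ∸ suc p *ℕ x) else 0ℤ) ≡ 0ℤ
  tooSmall x _ with suc p *ℕ x ≤ᵇ N
  ... | true = if-≰ _ (λ q → r≰N (N.≤-trans q (N.m∸n≤m N (suc p *ℕ x))))
  ... | false = refl
... | yes r≤N rewrite ≤⇒≤ᵇ≡true r≤N = begin
  Σ< (suc N) (λ x → if P x ≤ᵇ N then shift r (F x) (N ∸ P x) else 0ℤ)   ≡⟨ Σ<-cong (suc N) (λ x _ → combine x) ⟩
  Σ< (suc N) (λ x → if P x ≤ᵇ N ∸ r then F x (N ∸ r ∸ P x) else 0ℤ)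
    ≡⟨ Σ<-pad (suc (N ∸ r)) (suc N) (s≤s (N.m∸n≤m N r))
              (λ x a _ → if-≰ _ (λ q → N.<⇒≱ a (N.≤-trans (N.m≤n*m x (suc p)) q))) ⟩
  geoSum (suc p) F (N ∸ r) ∎
  where
  P : ℕ → ℕ
  P x = suc p *ℕ x
  combine : ∀ x → (if P x ≤ᵇ N then shift r (F x) (N ∸ P x) else 0ℤ)
                ≡ (if P x ≤ᵇ N ∸ r then F x (N ∸ r ∸ P x) else 0ℤ)
  combine x with P x ≤? N ∸ r
  ... | yes q rewrite ≤⇒≤ᵇ≡true q | ≤⇒≤ᵇ≡true (N.≤-trans q (N.m∸n≤m N r)) | ≤⇒≤ᵇ≡true (≤-∸-swap {r} {P x} {N} r≤N q)
        | N.∸-+-assoc N (P x) r | N.∸-+-assoc N r (P x) | N.+-comm r (P x) = refl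
  ... | no q rewrite ≰⇒≤ᵇ≡false q with P x ≤? N
  ...   | yes q' rewrite ≤⇒≤ᵇ≡true q' = if-≰ _ (λ q'' → q (≤-∸-swap {P x} {r} {N} q' q''))
  ...   | no q' rewrite ≰⇒≤ᵇ≡false q' = refl

Δ-geoSum : ∀ p r (F : ℕ → FPS) N → Δ r (geoSum (suc p) F) N ≡ geoSum (suc p) (λ x → Δ r (F x)) N
Δ-geoSum p r F N = sym (begin
  geoSum (suc p) (λ x M → F x M - shift r (F x) M) N     ≡⟨ geoSum-- (suc p) F (λ x → shift r (F x)) N ⟩
  geoSum (suc p) F N - geoSum (suc p) (λ x → shift r (F x)) N
    ≡⟨ cong (λ z → geoSum (suc p) F N - z) (geoSum-shift p r F N) ⟩
  Δ r (geoSum (suc p) F) N ∎)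

ΔΠ-geoSum : ∀ n k p (F : ℕ → FPS) N → ΔΠ k n (geoSum (suc p) F) N ≡ geoSum (suc p) (λ x → ΔΠ k n (F x)) N
ΔΠ-geoSum zero k p F N = refl
ΔΠ-geoSum (suc n) k p F N = trans (ΔΠ-cong n (suc k) N (λ M _ → Δ-geoSum p (suc k) F M) N N.≤-refl)
                                  (ΔΠ-geoSum n (suc k) p (λ x → Δ (suc k) (F x)) N)

ΔΠ-shift : ∀ n k p (f : FPS) N → ΔΠ k n (shift (suc p) f) N ≡ shift (suc p) (ΔΠ k n f) N
ΔΠ-shift n k p f N = begin
  ΔΠ k n (shift (suc p) f) N                   ≡⟨ ΔΠ-cong n k N (λ M _ → sym (geoSum-atSecond p f M)) N N.≤-refl ⟩
  ΔΠ k n (geoSum (suc p) (atSecond f)) N       ≡⟨ ΔΠ-geoSum n k p (atSecond f) N ⟩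
  geoSum (suc p) (λ x → ΔΠ k n (atSecond f x)) N
    ≡⟨ geoSum-cong (suc p) _ _ N (λ x M _ → concentrated x M) ⟩
  geoSum (suc p) (atSecond (ΔΠ k n f)) N       ≡⟨ geoSum-atSecond p (ΔΠ k n f) N ⟩
  shift (suc p) (ΔΠ k n f) N                   ∎
  where
  concentrated : ∀ x M → ΔΠ k n (atSecond f x) M ≡ atSecond (ΔΠ k n f) x M
  concentrated zero M = ΔΠ-zero n k M
  concentrated (suc zero) M = refl
  concentrated (suc (suc x)) M = ΔΠ-zero n k M

-- Generating functions of partitions with parts in {k+1, …, k+n}, obtained by summing
-- over the multiplicity x of the smallest part k+1:
--   partGF k n  counts each such partition once, i.e.  ∏_{j=k+1}^{k+n} 1/(1-q^j);
--   tsGF k n    weights it by tsGo k (its list of multiplicities), where a partition with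
--               x ≥ 1 parts k+1 contributes  (-1)^k (k+1) x  plus its weight from k+2 on.

partGF : ℕ → ℕ → FPS
partGF k zero = one
partGF k (suc n) = geoSum (suc k) (λ _ → partGF (suc k) n)

mutual
  tsGF : ℕ → ℕ → FPS
  tsGF k zero _ = 0ℤ
  tsGF k (suc n) = geoSum (suc k) (tsGF-term k n)

  tsGF-term : ℕ → ℕ → ℕ → FPS
  tsGF-term k n zero _ = 0ℤ
  tsGF-term k n (suc x) M = alt k * (+ (suc k *ℕ suc x)) * partGF (suc k) n M + tsGF (suc k) n M

Δ-partGF : ∀ k n M → Δ (suc k) (partGF k (suc n)) M ≡ partGF (suc k) n M
Δ-partGF k n M = begin
  partGF k (suc n) M - S                       ≡⟨ cong (_- S) (geoSum-unfold k (λ _ → partGF (suc k) n) M) ⟩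
  partGF (suc k) n M + S - S                   ≡⟨ cancel (partGF (suc k) n M) S ⟩
  partGF (suc k) n M                           ∎
  where
  S = shift (suc k) (partGF k (suc n)) M
  cancel : ∀ a b → a + b - b ≡ a
  cancel = solve-∀

ΔΠ-partGF : ∀ n k N → ΔΠ k n (partGF k n) N ≡ one N
ΔΠ-partGF zero k N = refl
ΔΠ-partGF (suc n) k N = trans (ΔΠ-cong n (suc k) N (λ M _ → Δ-partGF k n M) N N.≤-refl) (ΔΠ-partGF n (suc k) N)

-- The series  (-1)^k (k+1) · partGF (k+1) n / (1 - q^{k+1})  and its value  (-1)^k (k+1)/(1 - q^{k+1})
-- once the factors of partGF (k+1) n have been cancelled.

leadGF : ℕ → ℕ → FPS
leadGF k n = geoSum (suc k) (λ _ M → alt k * (+ suc k) * partGF (suc k) n M)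

altGeo : ℕ → FPS
altGeo k = geoSum (suc k) (λ _ M → alt k * (+ suc k) * one M)

tsGF-term-diff : ∀ k n x M → tsGF-term k n (suc x) M - tsGF-term k n x M
                             ≡ alt k * (+ suc k) * partGF (suc k) n M + atFirst (tsGF (suc k) n) x M
tsGF-term-diff k n zero M rewrite N.*-identityʳ k =
  dropZero (alt k) (+ suc k) (partGF (suc k) n M) (tsGF (suc k) n M)
  where
  dropZero : ∀ a p c t → (a * p * c + t) - 0ℤ ≡ a * p * c + t
  dropZero = solve-∀
tsGF-term-diff k n (suc y) M rewrite N.*-suc (suc k) (suc y) | Z.pos-+ (suc k) (suc k *ℕ suc y) =
  linear (alt k) (+ suc k) (+ (suc k *ℕ suc y)) (partGF (suc k) n M) (tsGF (suc k) n M)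
  where
  linear : ∀ a p q c t → (a * (p + q) * c + t) - (a * q * c + t) ≡ a * p * c + 0ℤ
  linear = solve-∀

Δ-tsGF : ∀ k n N → Δ (suc k) (tsGF k (suc n)) N ≡ shift (suc k) (λ M → leadGF k n M + tsGF (suc k) n M) N
Δ-tsGF k n N = begin
  tsGF k (suc n) N - shift p (tsGF k (suc n)) N
    ≡⟨ cong (_- shift p (tsGF k (suc n)) N) (geoSum-unfold k (tsGF-term k n) N) ⟩
  0ℤ + shift p (geoSum p (tsGF-term k n ∘ suc)) N - shift p (tsGF k (suc n)) N
    ≡⟨ cong (_- shift p (tsGF k (suc n)) N) (Z.+-identityˡ (shift p (geoSum p (tsGF-term k n ∘ suc)) N)) ⟩
  shift p (geoSum p (tsGF-term k n ∘ suc)) N - shift p (geoSum p (tsGF-term k n)) N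
    ≡⟨ shift-- p (geoSum p (tsGF-term k n ∘ suc)) (geoSum p (tsGF-term k n)) N ⟩
  shift p (λ M → geoSum p (tsGF-term k n ∘ suc) M - geoSum p (tsGF-term k n) M) N
    ≡⟨ shift-cong p telescope N ⟩
  shift p (λ M → leadGF k n M + tsGF (suc k) n M) N ∎
  where
  p = suc k
  telescope : ∀ M → geoSum p (tsGF-term k n ∘ suc) M - geoSum p (tsGF-term k n) M ≡ leadGF k n M + tsGF (suc k) n M
  telescope M = begin
    geoSum p (tsGF-term k n ∘ suc) M - geoSum p (tsGF-term k n) M
      ≡⟨ sym (geoSum-- p (tsGF-term k n ∘ suc) (tsGF-term k n) M) ⟩
    geoSum p (λ x M' → tsGF-term k n (suc x) M' - tsGF-term k n x M') M
      ≡⟨ geoSum-cong p _ _ M (λ x M' _ → tsGF-term-diff k n x M') ⟩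
    geoSum p (λ x M' → alt k * (+ suc k) * partGF (suc k) n M' + atFirst (tsGF (suc k) n) x M') M
      ≡⟨ geoSum-+ p (λ _ M' → alt k * (+ suc k) * partGF (suc k) n M') (atFirst (tsGF (suc k) n)) M ⟩
    leadGF k n M + geoSum p (atFirst (tsGF (suc k) n)) M
      ≡⟨ cong (λ z → leadGF k n M + z) (geoSum-atFirst k (tsGF (suc k) n) M) ⟩
    leadGF k n M + tsGF (suc k) n M ∎

reducedTs : ℕ → ℕ → FPS
reducedTs k n = ΔΠ k n (tsGF k n)

ΔΠ-leadGF : ∀ n k N → ΔΠ (suc k) n (leadGF k n) N ≡ altGeo k N
ΔΠ-leadGF n k N = trans (ΔΠ-geoSum n (suc k) k _ N) (geoSum-cong (suc k) _ _ N cancelPartGF)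
  where
  c = alt k * (+ suc k)
  cancelPartGF : ∀ x M → M ≤ N → ΔΠ (suc k) n (λ M' → c * partGF (suc k) n M') M ≡ c * one M
  cancelPartGF x M _ = trans (ΔΠ-* n (suc k) c (partGF (suc k) n) M) (cong (c *_) (ΔΠ-partGF n (suc k) M))

reducedTs-step : ∀ k n N → reducedTs k (suc n) N ≡ shift (suc k) (λ M → altGeo k M + reducedTs (suc k) n M) N
reducedTs-step k n N = begin
  ΔΠ (suc k) n (Δ (suc k) (tsGF k (suc n))) N
    ≡⟨ ΔΠ-cong n (suc k) N (λ M _ → Δ-tsGF k n M) N N.≤-refl ⟩
  ΔΠ (suc k) n (shift (suc k) (λ M → leadGF k n M + tsGF (suc k) n M)) N
    ≡⟨ ΔΠ-shift n (suc k) k _ N ⟩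
  shift (suc k) (ΔΠ (suc k) n (λ M → leadGF k n M + tsGF (suc k) n M)) N
    ≡⟨ shift-cong (suc k) (λ M → trans (ΔΠ-+ n (suc k) (leadGF k n) (tsGF (suc k) n) M)
                                       (cong (_+ reducedTs (suc k) n M) (ΔΠ-leadGF n k M))) N ⟩
  shift (suc k) (λ M → altGeo k M + reducedTs (suc k) n M) N ∎

-- The closed form.  triGap k n = (k+1) + … + (k+n+1), and  sTerm k n  is the series
-- (-1)^{k+n} (k+n+1) q^{triGap k n} / (1 - q^{k+n+1});  Sser is  Σ_{n' < N} sTerm 0 n'
-- in degree N.

tri-mono : ∀ {m n} → m ≤ n → tri m ≤ tri n
tri-mono z≤n = z≤n
tri-mono (s≤s m≤n) = N.+-mono-≤ (s≤s m≤n) (tri-mono m≤n)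

triGap : ℕ → ℕ → ℕ
triGap k n = tri (suc (k +ℕ n)) ∸ tri k

sTerm : ℕ → ℕ → FPS
sTerm k n N = Σ< (suc N) (λ j → if (triGap k n +ℕ suc (k +ℕ n) *ℕ j) ≡ᵇ N then alt (k +ℕ n) * (+ suc (k +ℕ n)) else 0ℤ)

sPartial : ℕ → ℕ → FPS
sPartial k n N = Σ< n (λ n' → sTerm k n' N)

-- Truncated subtraction in the form needed to split off the first summand of triGap.
∸-split : ∀ X a b → a +ℕ b ≤ X → X ∸ b ≡ a +ℕ (X ∸ (a +ℕ b))
∸-split X a b le = begin
  X ∸ b                    ≡⟨ cong (_∸ b) (sym (N.m∸n+n≡m le)) ⟩
  (Y +ℕ (a +ℕ b)) ∸ b      ≡⟨ cong (_∸ b) (sym (N.+-assoc Y a b)) ⟩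
  (Y +ℕ a +ℕ b) ∸ b        ≡⟨ N.m+n∸n≡m (Y +ℕ a) b ⟩
  Y +ℕ a                   ≡⟨ N.+-comm Y a ⟩
  a +ℕ Y                   ∎
  where Y = X ∸ (a +ℕ b)

triGap-zero : ∀ k → triGap k 0 ≡ suc k
triGap-zero k rewrite N.+-identityʳ k = N.m+n∸n≡m (suc k) (tri k)

triGap-suc : ∀ k n → triGap k (suc n) ≡ suc k +ℕ triGap (suc k) n
triGap-suc k n rewrite N.+-suc k n =
  ∸-split (tri (suc (suc (k +ℕ n)))) (suc k) (tri k) (tri-mono (s≤s (N.m≤n⇒m≤1+n (N.m≤m+n k n))))

Σ<-indicator-shift : ∀ p N (E : ℕ → ℕ) (v : ℤ) → (∀ j → j ≤ E j) →
  Σ< (suc N) (λ j → if p +ℕ E j ≡ᵇ N then v else 0ℤ)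
    ≡ shift p (λ M → Σ< (suc M) (λ j → if E j ≡ᵇ M then v else 0ℤ)) N
Σ<-indicator-shift p N E v hE with p ≤? N
... | no p≰N rewrite ≰⇒≤ᵇ≡false p≰N =
  Σ<-vanish (suc N) (λ j _ → cong (λ b → if b then v else 0ℤ) (≢⇒≡ᵇ≡false (λ e → p≰N (subst (p ≤_) e (N.m≤m+n p (E j))))))
... | yes p≤N rewrite ≤⇒≤ᵇ≡true p≤N = begin
  Σ< (suc N) (λ j → if p +ℕ E j ≡ᵇ N then v else 0ℤ)
    ≡⟨ Σ<-cong (suc N) (λ j _ → cong (λ b → if b then v else 0ℤ) (≡ᵇ-shift (E j) p≤N)) ⟩
  Σ< (suc N) (λ j → if E j ≡ᵇ N ∸ p then v else 0ℤ)
    ≡⟨ Σ<-pad (suc (N ∸ p)) (suc N) (s≤s (N.m∸n≤m N p))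
         (λ j a _ → cong (λ b → if b then v else 0ℤ) (≢⇒≡ᵇ≡false (λ e → N.<⇒≱ a (subst (j ≤_) e (hE j))))) ⟩
  Σ< (suc (N ∸ p)) (λ j → if E j ≡ᵇ N ∸ p then v else 0ℤ) ∎

shift-one : ∀ a M c → shift a (λ M' → c * one M') M ≡ (if a ≡ᵇ M then c else 0ℤ)
shift-one a M c with a ≤? M
... | no a≰M rewrite ≰⇒≤ᵇ≡false a≰M | ≢⇒≡ᵇ≡false {a} {M} (λ e → a≰M (N.≤-reflexive e)) = refl
... | yes a≤M rewrite ≤⇒≤ᵇ≡true a≤M with a N.≟ M
...   | yes refl rewrite N.n∸n≡0 a | ≡⇒≡ᵇ≡true {a} refl = Z.*-identityʳ c
...   | no a≢M rewrite ≢⇒≡ᵇ≡false a≢M with M ∸ a | N.m∸n+n≡m a≤M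
...     | zero | e = ⊥-elim (a≢M e)
...     | suc _ | _ = Z.*-zeroʳ c

sTerm-zero : ∀ k N → sTerm k 0 N ≡ shift (suc k) (altGeo k) N
sTerm-zero k N rewrite triGap-zero k | N.+-identityʳ k =
  trans (Σ<-indicator-shift (suc k) N (λ j → suc k *ℕ j) (alt k * + suc k) (λ j → N.m≤n*m j (suc k)))
        (shift-cong (suc k) (λ M → Σ<-cong (suc M) (λ x _ → sym (shift-one (suc k *ℕ x) M (alt k * + suc k)))) N)

sTerm-suc : ∀ k n N → sTerm k (suc n) N ≡ shift (suc k) (sTerm (suc k) n) N
sTerm-suc k n N = trans (Σ<-cong (suc N) (λ j _ → regroup j))
  (Σ<-indicator-shift (suc k) N E v (λ j → N.≤-trans (N.m≤n*m j (suc (suc k +ℕ n))) (N.m≤n+m _ (triGap (suc k) n))))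
  where
  E : ℕ → ℕ
  E j = triGap (suc k) n +ℕ suc (suc k +ℕ n) *ℕ j
  v : ℤ
  v = alt (suc k +ℕ n) * (+ suc (suc k +ℕ n))
  regroup : ∀ j → (if (triGap k (suc n) +ℕ suc (k +ℕ suc n) *ℕ j) ≡ᵇ N then alt (k +ℕ suc n) * (+ suc (k +ℕ suc n)) else 0ℤ)
                ≡ (if suc k +ℕ E j ≡ᵇ N then v else 0ℤ)
  regroup j = cong₂ (λ a w → if a ≡ᵇ N then w else 0ℤ)
    (trans (cong₂ _+ℕ_ (triGap-suc k n) (cong (λ z → suc z *ℕ j) (N.+-suc k n))) (N.+-assoc (suc k) (triGap (suc k) n) _))
    (cong (λ z → alt z * (+ suc z)) (N.+-suc k n))

reducedTs-closed : ∀ n k N → reducedTs k n N ≡ sPartial k n N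
reducedTs-closed zero k N = refl
reducedTs-closed (suc n) k N = begin
  reducedTs k (suc n) N                                         ≡⟨ reducedTs-step k n N ⟩
  shift (suc k) (λ M → altGeo k M + reducedTs (suc k) n M) N    ≡⟨ if-+ (suc k ≤ᵇ N) _ _ ⟩
  shift (suc k) (altGeo k) N + shift (suc k) (reducedTs (suc k) n) N
    ≡⟨ cong₂ _+_ (sym (sTerm-zero k N)) (shift-cong (suc k) (reducedTs-closed n (suc k)) N) ⟩
  sTerm k 0 N + shift (suc k) (sPartial (suc k) n) N
    ≡⟨ cong (λ z → sTerm k 0 N + z) (sym (Σ<-if n (suc k ≤ᵇ N) (λ n' → sTerm (suc k) n' (N ∸ suc k)))) ⟩
  sTerm k 0 N + Σ< n (λ n' → shift (suc k) (sTerm (suc k) n') N)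
    ≡⟨ cong (λ z → sTerm k 0 N + z) (Σ<-cong n (λ n' _ → sym (sTerm-suc k n' N))) ⟩
  sTerm k 0 N + Σ< n (λ n' → sTerm k (suc n') N)                ≡⟨ sym (Σ<-head n (λ n' → sTerm k n' N)) ⟩
  sPartial k (suc n) N                                          ∎

-- Parts larger than the degree do not matter: allowing the part k+n+1 changes
-- partGF and tsGF only in degrees > k+n.

partGF-stable : ∀ n k → AgreeUpTo (k +ℕ n) (partGF k (suc n)) (partGF k n)
partGF-stable zero k M M≤k = begin
  partGF k 1 M                                        ≡⟨ geoSum-unfold k (λ _ → one) M ⟩
  one M + shift (suc k) (partGF k 1) M                ≡⟨ cong (λ z → one M + z) (if-≰ _ (λ q → N.<⇒≱ q M≤k')) ⟩
  one M + 0ℤ                                          ≡⟨ Z.+-identityʳ (one M) ⟩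
  one M                                               ∎
  where M≤k' = subst (M ≤_) (N.+-identityʳ k) M≤k
partGF-stable (suc m) k M le = geoSum-cong (suc k) _ _ M
  (λ x M' M'≤M → partGF-stable m (suc k) M' (N.≤-trans M'≤M (subst (M ≤_) (N.+-suc k m) le)))

tsGF-stable : ∀ n k → AgreeUpTo (k +ℕ n) (tsGF k (suc n)) (tsGF k n)
tsGF-stable zero k M M≤k = begin
  tsGF k 1 M                                          ≡⟨ geoSum-unfold k (tsGF-term k 0) M ⟩
  0ℤ + shift (suc k) (geoSum (suc k) (tsGF-term k 0 ∘ suc)) M
    ≡⟨ cong (λ z → 0ℤ + z) (if-≰ _ (λ q → N.<⇒≱ q M≤k')) ⟩
  0ℤ                                                  ∎
  where M≤k' = subst (M ≤_) (N.+-identityʳ k) M≤k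
tsGF-stable (suc m) k M le = geoSum-cong (suc k) _ _ M sameTerms
  where
  le' : M ≤ suc k +ℕ m
  le' = subst (M ≤_) (N.+-suc k m) le
  sameTerms : ∀ x → AgreeUpTo M (tsGF-term k (suc m) x) (tsGF-term k m x)
  sameTerms zero M' _ = refl
  sameTerms (suc y) M' M'≤M = cong₂ (λ a b → alt k * (+ (suc k *ℕ suc y)) * a + b)
    (partGF-stable m (suc k) M' (N.≤-trans M'≤M le')) (tsGF-stable m (suc k) M' (N.≤-trans M'≤M le'))

tsGF-saturates : ∀ N M → M ≤ N → tsGF 0 M M ≡ tsGF 0 N M
tsGF-saturates N M M≤N = trans (sym (extend (N ∸ M))) (cong (λ z → tsGF 0 z M) (N.m+[n∸m]≡n M≤N))
  where
  extend : ∀ d → tsGF 0 (M +ℕ d) M ≡ tsGF 0 M M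
  extend zero rewrite N.+-identityʳ M = refl
  extend (suc d) rewrite N.+-suc M d = trans (tsGF-stable (M +ℕ d) 0 M (N.m≤m+n M d)) (extend d)

sumℤ-++ : ∀ (xs ys : List ℤ) → sumℤ (xs ++ ys) ≡ sumℤ xs + sumℤ ys
sumℤ-++ [] ys = sym (Z.+-identityˡ _)
sumℤ-++ (x ∷ xs) ys rewrite sumℤ-++ xs ys = sym (Z.+-assoc x _ _)

sumℤ-concatMap : ∀ {A B : Set} (h : B → ℤ) (f : A → List B) (xs : List A) →
  sumℤ (map h (concatMap f xs)) ≡ sumℤ (map (λ x → sumℤ (map h (f x))) xs)
sumℤ-concatMap h f [] = refl
sumℤ-concatMap h f (x ∷ xs) = begin
  sumℤ (map h (f x ++ concatMap f xs))                  ≡⟨ cong sumℤ (map-++ h (f x) (concatMap f xs)) ⟩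
  sumℤ (map h (f x) ++ map h (concatMap f xs))          ≡⟨ sumℤ-++ (map h (f x)) _ ⟩
  sumℤ (map h (f x)) + sumℤ (map h (concatMap f xs))    ≡⟨ cong (λ z → sumℤ (map h (f x)) + z) (sumℤ-concatMap h f xs) ⟩
  sumℤ (map (λ x → sumℤ (map h (f x))) (x ∷ xs))       ∎

sumℤ-applyUpTo : ∀ m (a : ℕ → ℤ) → sumℤ (applyUpTo a m) ≡ Σ< m a
sumℤ-applyUpTo zero a = refl
sumℤ-applyUpTo (suc m) a = trans (cong (λ z → a 0 + z) (sumℤ-applyUpTo m (a ∘ suc))) (sym (Σ<-head m a))

sumℤ-map-cong : ∀ {A : Set} (h h' : A → ℤ) (L : List A) → (∀ v → h v ≡ h' v) → sumℤ (map h L) ≡ sumℤ (map h' L)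
sumℤ-map-cong h h' [] e = refl
sumℤ-map-cong h h' (x ∷ L) e = cong₂ _+_ (e x) (sumℤ-map-cong h h' L e)

sumℤ-map-vanish : ∀ {A : Set} (h : A → ℤ) (L : List A) → (∀ v → h v ≡ 0ℤ) → sumℤ (map h L) ≡ 0ℤ
sumℤ-map-vanish h [] e = refl
sumℤ-map-vanish h (x ∷ L) e rewrite e x | sumℤ-map-vanish h L e = refl

sumℤ-map-linear : ∀ {A : Set} c (h h' : A → ℤ) (L : List A) →
  sumℤ (map (λ v → c * h v + h' v) L) ≡ c * sumℤ (map h L) + sumℤ (map h' L)
sumℤ-map-linear c h h' [] = sym (trans (Z.+-identityʳ (c * 0ℤ)) (Z.*-zeroʳ c))
sumℤ-map-linear c h h' (x ∷ L) rewrite sumℤ-map-linear c h h' L =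
  regroup c (h x) (h' x) (sumℤ (map h L)) (sumℤ (map h' L))
  where
  regroup : ∀ c a b s t → (c * a + b) + (c * s + t) ≡ c * (a + s) + (b + t)
  regroup = solve-∀

sumℤ-filter : ∀ {A : Set} (P : A → Bool) (g : A → ℤ) (L : List A) →
  sumℤ (map g (filterᵇ P L)) ≡ sumℤ (map (λ v → if P v then g v else 0ℤ) L)
sumℤ-filter P g [] = refl
sumℤ-filter P g (x ∷ L) with P x
... | true = cong (λ z → g x + z) (sumℤ-filter P g L)
... | false = trans (sumℤ-filter P g L) (sym (Z.+-identityˡ _))

restrictedSum : ℕ → (n : ℕ) → ℕ → ℕ → (Vec ℕ n → ℤ) → ℤ
restrictedSum k n B N g = sumℤ (map (λ v → if weight (suc k) v ≡ᵇ N then g v else 0ℤ) (boundedVecs n B))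

restrictedSum-step : ∀ k n B N (g : Vec ℕ (suc n) → ℤ) →
  restrictedSum k (suc n) B N g
    ≡ Σ< (suc B) (λ x → if suc k *ℕ x ≤ᵇ N then restrictedSum (suc k) n B (N ∸ suc k *ℕ x) (λ v → g (x ∷ v)) else 0ℤ)
restrictedSum-step k n B N g = begin
  sumℤ (map H (concatMap (λ x → map (x ∷_) (boundedVecs n B)) (upTo (suc B))))
    ≡⟨ sumℤ-concatMap H (λ x → map (x ∷_) (boundedVecs n B)) (upTo (suc B)) ⟩
  sumℤ (map (λ x → sumℤ (map H (map (x ∷_) (boundedVecs n B)))) (upTo (suc B)))
    ≡⟨ cong sumℤ (map-upTo (λ x → sumℤ (map H (map (x ∷_) (boundedVecs n B)))) (suc B)) ⟩
  sumℤ (applyUpTo (λ x → sumℤ (map H (map (x ∷_) (boundedVecs n B)))) (suc B))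
    ≡⟨ sumℤ-applyUpTo (suc B) _ ⟩
  Σ< (suc B) (λ x → sumℤ (map H (map (x ∷_) (boundedVecs n B))))
    ≡⟨ Σ<-cong (suc B) (λ x _ → trans (cong sumℤ (sym (map-∘ (boundedVecs n B)))) (firstEntry x)) ⟩
  Σ< (suc B) (λ x → if suc k *ℕ x ≤ᵇ N then restrictedSum (suc k) n B (N ∸ suc k *ℕ x) (λ v → g (x ∷ v)) else 0ℤ) ∎
  where
  H : Vec ℕ (suc n) → ℤ
  H v = if weight (suc k) v ≡ᵇ N then g v else 0ℤ
  firstEntry : ∀ x → sumℤ (map (λ v → H (x ∷ v)) (boundedVecs n B))
                   ≡ (if suc k *ℕ x ≤ᵇ N then restrictedSum (suc k) n B (N ∸ suc k *ℕ x) (λ v → g (x ∷ v)) else 0ℤ)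
  firstEntry x with suc k *ℕ x ≤? N
  ... | yes q rewrite ≤⇒≤ᵇ≡true q = sumℤ-map-cong _ _ (boundedVecs n B)
          (λ v → cong (λ b → if b then g (x ∷ v) else 0ℤ) (≡ᵇ-shift (weight (suc (suc k)) v) q))
  ... | no q rewrite ≰⇒≤ᵇ≡false q = sumℤ-map-vanish _ (boundedVecs n B)
          (λ v → cong (λ b → if b then g (x ∷ v) else 0ℤ) (≢⇒≡ᵇ≡false (λ e → q (subst (suc k *ℕ x ≤_) e (N.m≤m+n _ _)))))

-- Multiplicities beyond N/(k+1) do not contribute, so the bound B ≥ N is irrelevant.
Σ<-geoSum : ∀ k N B (F : ℕ → FPS) → N ≤ B →
  Σ< (suc B) (λ x → if suc k *ℕ x ≤ᵇ N then F x (N ∸ suc k *ℕ x) else 0ℤ) ≡ geoSum (suc k) F N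
Σ<-geoSum k N B F N≤B = Σ<-pad (suc N) (suc B) (s≤s N≤B)
  (λ x a _ → if-≰ _ (λ q → N.<⇒≱ a (N.≤-trans (N.m≤n*m x (suc k)) q)))

restrictedSum-partGF : ∀ n k B N → N ≤ B → restrictedSum k n B N (λ _ → 1ℤ) ≡ partGF k n N
restrictedSum-partGF zero k B zero _ = refl
restrictedSum-partGF zero k B (suc N) _ = refl
restrictedSum-partGF (suc n) k B N N≤B = begin
  restrictedSum k (suc n) B N (λ _ → 1ℤ)        ≡⟨ restrictedSum-step k n B N (λ _ → 1ℤ) ⟩
  Σ< (suc B) (λ x → if suc k *ℕ x ≤ᵇ N then restrictedSum (suc k) n B (N ∸ suc k *ℕ x) (λ _ → 1ℤ) else 0ℤ)
    ≡⟨ Σ<-cong (suc B) (λ x _ → if-cong refl (restrictedSum-partGF n (suc k) B (N ∸ suc k *ℕ x)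
                                                (N.≤-trans (N.m∸n≤m N (suc k *ℕ x)) N≤B))) ⟩
  Σ< (suc B) (λ x → if suc k *ℕ x ≤ᵇ N then partGF (suc k) n (N ∸ suc k *ℕ x) else 0ℤ)
    ≡⟨ Σ<-geoSum k N B (λ _ → partGF (suc k) n) N≤B ⟩
  partGF k (suc n) N                             ∎

restrictedSum-tsGo : ∀ n k B N → N ≤ B → restrictedSum k n B N (λ v → tsGo k (toList v)) ≡ tsGF k n N
restrictedSum-tsGo zero k B N _ = trans (Z.+-identityʳ _) (if-0 (0 ≡ᵇ N))
restrictedSum-tsGo (suc n) k B N N≤B = begin
  restrictedSum k (suc n) B N (λ v → tsGo k (toList v))   ≡⟨ restrictedSum-step k n B N (λ v → tsGo k (toList v)) ⟩
  Σ< (suc B) (λ x → if suc k *ℕ x ≤ᵇ N then restrictedSum (suc k) n B (N ∸ suc k *ℕ x) (λ v → tsGo k (x ∷ toList v)) else 0ℤ)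
    ≡⟨ Σ<-cong (suc B) (λ x _ → if-cong refl (byFirst x (N ∸ suc k *ℕ x) (N.≤-trans (N.m∸n≤m N (suc k *ℕ x)) N≤B))) ⟩
  Σ< (suc B) (λ x → if suc k *ℕ x ≤ᵇ N then tsGF-term k n x (N ∸ suc k *ℕ x) else 0ℤ)
    ≡⟨ Σ<-geoSum k N B (tsGF-term k n) N≤B ⟩
  tsGF k (suc n) N                                        ∎
  where
  byFirst : ∀ x M → M ≤ B → restrictedSum (suc k) n B M (λ v → tsGo k (x ∷ toList v)) ≡ tsGF-term k n x M
  byFirst zero M _ = sumℤ-map-vanish _ (boundedVecs n B) (λ v → if-0 _)
  byFirst (suc y) M M≤B = begin
    sumℤ (map (λ v → if weight (suc (suc k)) v ≡ᵇ M then c + tsGo (suc k) (toList v) else 0ℤ) (boundedVecs n B))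
      ≡⟨ sumℤ-map-cong _ _ (boundedVecs n B) (λ v → if-affine _ c _) ⟩
    sumℤ (map (λ v → c * (if weight (suc (suc k)) v ≡ᵇ M then 1ℤ else 0ℤ)
                     + (if weight (suc (suc k)) v ≡ᵇ M then tsGo (suc k) (toList v) else 0ℤ)) (boundedVecs n B))
      ≡⟨ sumℤ-map-linear c _ _ (boundedVecs n B) ⟩
    c * restrictedSum (suc k) n B M (λ _ → 1ℤ) + restrictedSum (suc k) n B M (λ v → tsGo (suc k) (toList v))
      ≡⟨ cong₂ (λ a b → c * a + b) (restrictedSum-partGF n (suc k) B M M≤B) (restrictedSum-tsGo n (suc k) B M M≤B) ⟩
    tsGF-term k n (suc y) M ∎
    where
    c = alt k * (+ (suc k *ℕ suc y))

tsSeries-tsGF : ∀ M → tsSeries M ≡ tsGF 0 M M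
tsSeries-tsGF M = trans (sumℤ-filter (λ m → weight 1 m ≡ᵇ M) ts (boundedVecs M M))
                        (restrictedSum-tsGo M 0 M M N.≤-refl)

qPochInf-tsSeries : ∀ N → (qPochInf ⊛ tsSeries) N ≡ Sser N
qPochInf-tsSeries N = begin
  (qPochInf ⊛ tsSeries) N   ≡⟨ qPochInf-⊛ tsSeries N ⟩
  ΔΠ 0 N tsSeries N         ≡⟨ ΔΠ-cong N 0 N (λ M M≤N → trans (tsSeries-tsGF M) (tsGF-saturates N M M≤N)) N N.≤-refl ⟩
  reducedTs 0 N N           ≡⟨ reducedTs-closed N 0 N ⟩
  Sser N                    ∎

theorem1p3 : (N : ℕ) → Aser N ≡ tsSeries N
theorem1p3 = inv-solve qPochInf tsSeries Sser refl qPochInf-tsSeries
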